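{- Let $K$ be a field and let $P,Q\in K[X,Y]$ be relatively prime homogeneous polynomials of degree $2$, with homogeneous differential $D_{P,Q}$. Then $\Delta(D_{P,Q})=4\operatorname{Res}(P,Q)$.
   Context: For homogeneous $P=\prod_{i=1}^m(b_iX-a_iY)$, $Q=\prod_{j=1}^n(d_jX-c_jY)$ over $\overline K$ (each pair not both zero), $\operatorname{Res}(P,Q)=\prod_{i,j}(a_id_j-b_ic_j)$ and $\Delta(P)=\prod_{1\le i<j\le m}(a_ib_j-b_ia_j)^2$. The homogeneous differential is $D_{P,Q}=\frac1Y(P_XQ-PQ_X)=\frac1X(PQ_Y-P_YQ)$, with formal partial derivatives. -}

module Defs where

open import Level using (Level; _⊔_) renaming (suc to lsuc)
open import Algebra.Bundles using (CommutativeRing)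
open import Data.Nat as ℕ using (ℕ; zero; suc; _∸_)
open import Data.Fin using (Fin; zero; suc; toℕ; fromℕ<; inject₁)
open import Data.Product using (∃; _×_)
open import Relation.Nullary using (¬_; yes; no)

record Field (c ℓ : Level) : Set (lsuc (c ⊔ ℓ)) where
  field
    commutativeRing : CommutativeRing c ℓ
  open CommutativeRing commutativeRing public
  field
    0≉1     : ¬ (0# ≈ 1#)
    inverse : ∀ x → ¬ (x ≈ 0#) → ∃ λ y → x * y ≈ 1#

module HomogeneousPolynomials {c ℓ : Level} (K : Field c ℓ) where
  open Field K using (Carrier; _≈_; _+_; _*_; _-_; 0#; 1#)

  -- A homogeneous polynomial of degree d in K[X,Y]:
  -- P i is the coefficient of X^(d - i) Y^i, for i = 0 .. d.
  HP : ℕ → Set c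
  HP d = Fin (suc d) → Carrier

  _≋_ : ∀ {d} → HP d → HP d → Set ℓ
  P ≋ Q = ∀ i → P i ≈ Q i

  zeroP : ∀ {d} → HP d
  zeroP _ = 0#

  _·_ : ℕ → Carrier → Carrier
  zero  · x = 0#
  suc n · x = x + n · x

  coeff : ∀ {d} → HP d → ℕ → Carrier
  coeff {d} P i with i ℕ.<? suc d
  ... | yes i<d = P (fromℕ< i<d)
  ... | no  _   = 0#

  sumUpTo : ℕ → (ℕ → Carrier) → Carrier
  sumUpTo zero    f = f 0
  sumUpTo (suc k) f = sumUpTo k f + f (suc k)

  _⊛_ : ∀ {m n} → HP m → HP n → HP (m ℕ.+ n)
  (P ⊛ Q) k = sumUpTo (toℕ k) (λ i → coeff P i * coeff Q (toℕ k ∸ i))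

  _⊝_ : ∀ {d} → HP d → HP d → HP d
  (P ⊝ Q) i = P i - Q i

  _⊙_ : ∀ {d} → Carrier → HP d → HP d
  (a ⊙ P) i = a * P i

  mulY : ∀ {d} → HP d → HP (suc d)
  mulY R zero    = 0#
  mulY R (suc i) = R i

  ∂X : ∀ {d} → HP (suc d) → HP d
  ∂X {d} P i = (suc d ∸ toℕ i) · P (inject₁ i)

  ∂Y : ∀ {d} → HP (suc d) → HP d
  ∂Y P i = suc (toℕ i) · P (suc i)

  -- P and Q (of degree 2) are relatively prime in K[X,Y]: they have no
  -- nonconstant common factor. (Any factor of a nonzero homogeneous
  -- polynomial is homogeneous, so a common factor is either a linear
  -- form or a quadratic form with constant cofactors.)
  RelPrime₂ : HP 2 → HP 2 → Set (c ⊔ ℓ)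
  RelPrime₂ P Q =
    (∀ (F G H : HP 1) → (F ⊛ G) ≋ P → (F ⊛ H) ≋ Q → F ≋ zeroP)
    × (∀ (F : HP 2) (a b : Carrier) → (a ⊙ F) ≋ P → (b ⊙ F) ≋ Q → F ≋ zeroP)

  -- discriminant of the binary quadratic form p0 X² + p1 XY + p2 Y²
  -- (equals (a1 b2 - b1 a2)² for P = (b1 X - a1 Y)(b2 X - a2 Y))
  disc₂ : HP 2 → Carrier
  disc₂ P = P (suc zero) * P (suc zero) - 4 · (P zero * P (suc (suc zero)))

  -- resultant of two binary quadratic forms (Sylvester determinant, expanded);
  -- equals ∏_{i,j} (a_i d_j - b_i c_j) for the factorizations over K̄
  res₂ : HP 2 → HP 2 → Carrier
  res₂ P Q =
    (p0 * q2 - p2 * q0) * (p0 * q2 - p2 * q0) - (p0 * q1 - p1 * q0) * (p1 * q2 - p2 * q1)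
    where
      p0 = P zero
      p1 = P (suc zero)
      p2 = P (suc (suc zero))
      q0 = Q zero
      q1 = Q (suc zero)
      q2 = Q (suc (suc zero))

{-# OPTIONS --safe #-}
module Submission where

open import Level using (Level)
open import Data.Nat using (zero; suc)
open import Data.Fin using (zero; suc)
open import Algebra.Bundles using (AbelianGroup)
import Algebra.Properties.AbelianGroup as AbelianGroupProperties
import Algebra.Properties.CommutativeMonoid.Mult as CommutativeMonoidMultiplication
import Algebra.Solver.Ring.NaturalCoefficients.Default as ℕ-CoefficientSolver
import Relation.Binary.Reasoning.Setoid as SetoidReasoning
open import Defs

-- For P = p₀X² + p₁XY + p₂Y² and Q = q₀X² + q₁XY + q₂Y², the X³ coefficients of
-- P_X Q and P Q_X cancel, and dividing the difference by Y leaves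
--   D = (p₀q₁ − p₁q₀) X² + 2 (p₀q₂ − p₂q₀) XY + (p₁q₂ − p₂q₁) Y².
-- Hence Δ(D) = 4 ((p₀q₂ − p₂q₀)² − (p₀q₁ − p₁q₀)(p₁q₂ − p₂q₁)), which is four times
-- the Sylvester resultant. This is a polynomial identity in the coefficients, so the
-- coprimality of P and Q is never used.

module Differences {a ℓ : Level} (G : AbelianGroup a ℓ) where
  open AbelianGroup G
  open AbelianGroupProperties G using (⁻¹-∙-comm; ε⁻¹≈ε)
  open CommutativeMonoidMultiplication commutativeMonoid using (_×_; ×-distrib-+)
  open SetoidReasoning setoid

  x-y≈[x∙z]-[z∙y] : ∀ x y z → x - y ≈ (x ∙ z) - (z ∙ y)
  x-y≈[x∙z]-[z∙y] x y z = sym (begin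
    (x ∙ z) ∙ (z ∙ y) ⁻¹      ≈⟨ ∙-congˡ (⁻¹-∙-comm z y) ⟨
    (x ∙ z) ∙ (z ⁻¹ ∙ y ⁻¹)   ≈⟨ assoc x z _ ⟩
    x ∙ (z ∙ (z ⁻¹ ∙ y ⁻¹))   ≈⟨ ∙-congˡ (assoc z (z ⁻¹) (y ⁻¹)) ⟨
    x ∙ ((z ∙ z ⁻¹) ∙ y ⁻¹)   ≈⟨ ∙-congˡ (∙-congʳ (inverseʳ z)) ⟩
    x ∙ (ε ∙ y ⁻¹)            ≈⟨ ∙-congˡ (identityˡ (y ⁻¹)) ⟩
    x - y                     ∎)

  x∙v≈u∙y⇒x-y≈u-v : ∀ {x y u v} → x ∙ v ≈ u ∙ y → x - y ≈ u - v
  x∙v≈u∙y⇒x-y≈u-v {x} {y} {u} {v} x∙v≈u∙y = begin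
    x - y                ≈⟨ x-y≈[x∙z]-[z∙y] x y v ⟩
    (x ∙ v) - (v ∙ y)    ≈⟨ ∙-cong x∙v≈u∙y (⁻¹-cong (comm v y)) ⟩
    (u ∙ y) - (y ∙ v)    ≈⟨ x-y≈[x∙z]-[z∙y] u v y ⟨
    u - v                ∎

  ×-homo-⁻¹ : ∀ x n → n × (x ⁻¹) ≈ (n × x) ⁻¹
  ×-homo-⁻¹ x zero    = sym ε⁻¹≈ε
  ×-homo-⁻¹ x (suc n) = trans (∙-congˡ (×-homo-⁻¹ x n)) (⁻¹-∙-comm x (n × x))

  ×-distrib‿- : ∀ x y n → n × (x - y) ≈ n × x - n × y
  ×-distrib‿- x y n = trans (×-distrib-+ x (y ⁻¹) n) (∙-congˡ (×-homo-⁻¹ y n))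

module QuadraticForms {c ℓ : Level} (K : Field c ℓ) where
  open Field K hiding (zero)
  open HomogeneousPolynomials K
  -- For numerals, Defs' n · x and the library's n × x over +-monoid unfold to the same
  -- sum x + (x + … + 0#), so the library lemmas about _×_ apply to _·_ at n = 2, 4.
  open Differences +-abelianGroup using (x∙v≈u∙y⇒x-y≈u-v; ×-distrib‿-)
  open AbelianGroupProperties +-abelianGroup using (x≈y⇒x∙y⁻¹≈ε)
  open CommutativeMonoidMultiplication +-commutativeMonoid using (×-congʳ)
  open ℕ-CoefficientSolver commutativeSemiring using (solve; _:=_; con; _:+_; _:*_; _:×_)
  open SetoidReasoning setoid

  form₂ : Carrier → Carrier → Carrier → HP 2
  form₂ a b c zero             = a
  form₂ a b c (suc zero)       = b
  form₂ a b c (suc (suc zero)) = c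

  disc₂-cong : ∀ {D E : HP 2} → D ≋ E → disc₂ D ≈ disc₂ E
  disc₂-cong D≋E =
    +-cong (*-cong (D≋E (suc zero)) (D≋E (suc zero)))
           (-‿cong (×-congʳ 4 (*-cong (D≋E zero) (D≋E (suc (suc zero))))))

  mulY-injective : ∀ {d} {D E : HP d} → mulY D ≋ mulY E → D ≋ E
  mulY-injective mulY-D≋E i = mulY-D≋E (suc i)

  module _ (P Q : HP 2) where
    private
      p₀ p₁ p₂ q₀ q₁ q₂ : Carrier
      p₀ = P zero ; p₁ = P (suc zero) ; p₂ = P (suc (suc zero))
      q₀ = Q zero ; q₁ = Q (suc zero) ; q₂ = Q (suc (suc zero))

    differential₂ : HP 2
    differential₂ = form₂ (p₀ * q₁ - p₁ * q₀) (2 · (p₀ * q₂ - p₂ * q₀)) (p₁ * q₂ - p₂ * q₁)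

    -- K has no decidable equality, so no ring solver over K applies; subtractions are
    -- cleared by x∙v≈u∙y⇒x-y≈u-v and the rest is left to the ℕ-coefficient semiring
    -- solver. Its identities carry the factors 2· and 1· from ∂X and the padding zeros
    -- from coeff, exactly as _⊛_ and ∂X unfold.
    mulY-differential₂ : mulY differential₂ ≋ ((∂X P ⊛ Q) ⊝ (P ⊛ ∂X Q))
    mulY-differential₂ zero =
      sym (x≈y⇒x∙y⁻¹≈ε (solve 2 (λ p₀ q₀ →
        2 :× p₀ :* q₀ := p₀ :* 2 :× q₀) refl p₀ q₀))
    mulY-differential₂ (suc zero) =
      x∙v≈u∙y⇒x-y≈u-v (solve 4 (λ p₀ p₁ q₀ q₁ →
        p₀ :* q₁ :+ (p₀ :* 1 :× q₁ :+ p₁ :* 2 :× q₀)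
          := (2 :× p₀ :* q₁ :+ 1 :× p₁ :* q₀) :+ p₁ :* q₀) refl p₀ p₁ q₀ q₁)
    mulY-differential₂ (suc (suc zero)) = trans (×-distrib‿- (p₀ * q₂) (p₂ * q₀) 2)
      (x∙v≈u∙y⇒x-y≈u-v (solve 6 (λ p₀ p₁ p₂ q₀ q₁ q₂ →
        2 :× (p₀ :* q₂) :+ ((p₀ :* con 0 :+ p₁ :* 1 :× q₁) :+ p₂ :* 2 :× q₀)
          := ((2 :× p₀ :* q₂ :+ 1 :× p₁ :* q₁) :+ con 0 :* q₀) :+ 2 :× (p₂ :* q₀))
        refl p₀ p₁ p₂ q₀ q₁ q₂))
    mulY-differential₂ (suc (suc (suc zero))) =
      x∙v≈u∙y⇒x-y≈u-v (solve 6 (λ p₀ p₁ p₂ q₀ q₁ q₂ →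
        p₁ :* q₂ :+ (((p₀ :* con 0 :+ p₁ :* con 0) :+ p₂ :* 1 :× q₁) :+ con 0 :* 2 :× q₀)
          := (((2 :× p₀ :* con 0 :+ 1 :× p₁ :* q₂) :+ con 0 :* q₁) :+ con 0 :* q₀) :+ p₂ :* q₁)
        refl p₀ p₁ p₂ q₀ q₁ q₂)

    disc₂-differential₂ : disc₂ differential₂ ≈ 4 · res₂ P Q
    disc₂-differential₂ = begin
      2 · a * 2 · a - 4 · (b * d)  ≈⟨ +-congʳ (solve 1 (λ a → 2 :× a :* 2 :× a := 4 :× (a :* a)) refl a) ⟩
      4 · (a * a) - 4 · (b * d)    ≈⟨ ×-distrib‿- (a * a) (b * d) 4 ⟨
      4 · (a * a - b * d)          ∎
      where
        a b d : Carrier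
        a = p₀ * q₂ - p₂ * q₀
        b = p₀ * q₁ - p₁ * q₀
        d = p₁ * q₂ - p₂ * q₁

proposition3p7 : ∀ {c ℓ : Level} (K : Field c ℓ) →
    let open Field K
        open HomogeneousPolynomials K
    in ∀ (P Q : HP 2) → RelPrime₂ P Q →
       ∀ (D : HP 2) → mulY D ≋ ((∂X P ⊛ Q) ⊝ (P ⊛ ∂X Q)) →
       disc₂ D ≈ 4 · res₂ P Q
proposition3p7 K P Q _ D mulY-D≋ = begin
  disc₂ D                   ≈⟨ disc₂-cong D≋differential₂ ⟩
  disc₂ (differential₂ P Q) ≈⟨ disc₂-differential₂ P Q ⟩
  4 · res₂ P Q              ∎
  where
    open Field K using (setoid; trans; sym)
    open HomogeneousPolynomials K
    open QuadraticForms K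
    open SetoidReasoning setoid
    D≋differential₂ : D ≋ differential₂ P Q
    D≋differential₂ = mulY-injective (λ i → trans (mulY-D≋ i) (sym (mulY-differential₂ P Q i)))
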